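{- For integers $1\le \ell\le 7$ and $0\le q\le 7$, the values $D(\ell,q)$ are as follows: $D(1,0)=1$; $D(2,0)=2$; $D(3,0)=4$; $D(4,0)=8$, $D(4,1)=4$; $D(5,0)=16$, $D(5,1)=8$; $D(6,0)=16$, $D(6,1)=16$, $D(6,3)=8$; $D(7,0)=32$, $D(7,1)=32$, $D(7,2)=16$, $D(7,3)=16$, $D(7,7)=8$; and $D(\ell,q)=\infty$ for every other pair $(\ell,q)$ with $1\le\ell\le7$ and $0\le q\le 7$.
   Context: The EvenQuads-$2^n$ deck is the set $\mathbb{Z}_2^n$ ($n\ge 0$), whose elements are called cards. A quad is a set of four distinct cards $\vec a,\vec b,\vec c,\vec d$ with $\vec a+\vec b+\vec c+\vec d=\vec 0$. For a set $S$ of cards, the number of quads in $S$ is the number of 4-element subsets of $S$ that are quads. $D(\ell,q)$ denotes the smallest deck size $2^n$ such that there exists a set of $\ell$ distinct cards in $\mathbb{Z}_2^n$ containing exactly $q$ quads; if no such $n$ exists, $D(\ell,q)=\infty$. -}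

module Defs where

open import Data.Nat using (ℕ; _<_; _^_)
open import Data.Bool using (Bool; false; _xor_)
open import Data.Fin using (Fin) renaming (_<_ to _<ᶠ_; _<?_ to _<ᶠ?_)
open import Data.Vec using (Vec; zipWith; replicate; lookup)
open import Data.Vec.Properties using (≡-dec)
open import Data.Bool.Properties using () renaming (_≟_ to _≟ᵇ_)
open import Data.List using (List; allFin; concatMap; filter; length; [_]; [])
open import Data.Product using (Σ; _×_; _,_; proj₁)
open import Data.Maybe using (Maybe; just; nothing)
open import Relation.Nullary using (¬_; Dec; yes; no)
open import Relation.Nullary.Decidable using (_×-dec_)
open import Relation.Binary.PropositionalEquality using (_≡_)
open import Function.Definitions using (Injective)

-- A card of the EvenQuads-2^n deck: an element of Z_2^n.
Card : ℕ → Set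
Card n = Vec Bool n

_⊕_ : ∀ {n} → Card n → Card n → Card n
_⊕_ = zipWith _xor_

𝟎 : ∀ {n} → Card n
𝟎 = replicate _ false

SumZero : ∀ {n} → Card n → Card n → Card n → Card n → Set
SumZero a b c d = ((a ⊕ b) ⊕ c) ⊕ d ≡ 𝟎

sumZero? : ∀ {n} (a b c d : Card n) → Dec (SumZero a b c d)
sumZero? a b c d = ≡-dec _≟ᵇ_ (((a ⊕ b) ⊕ c) ⊕ d) 𝟎

record CardSet (n ℓ : ℕ) : Set where
  field
    cards    : Vec (Card n) ℓ
    distinct : Injective _≡_ _≡_ (lookup cards)
open CardSet public

Quadruple : ℕ → Set
Quadruple ℓ = Fin ℓ × Fin ℓ × Fin ℓ × Fin ℓ

Increasing : ∀ {ℓ} → Quadruple ℓ → Set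
Increasing (i , j , k , m) = (i <ᶠ j) × (j <ᶠ k) × (k <ᶠ m)

increasing? : ∀ {ℓ} (t : Quadruple ℓ) → Dec (Increasing t)
increasing? (i , j , k , m) = (i <ᶠ? j) ×-dec ((j <ᶠ? k) ×-dec (k <ᶠ? m))

allQuadruples : ∀ ℓ → List (Quadruple ℓ)
allQuadruples ℓ =
  concatMap (λ i → concatMap (λ j → concatMap (λ k → concatMap
    (λ m → [ (i , j , k , m) ]) (allFin ℓ)) (allFin ℓ)) (allFin ℓ)) (allFin ℓ)

-- 4-element subsets of the card set (cards are distinct, so these are
-- exactly the 4-element subsets of S)
fourSubsets : ∀ ℓ → List (Quadruple ℓ)
fourSubsets ℓ = filter increasing? (allQuadruples ℓ)

numQuads : ∀ {n ℓ} → CardSet n ℓ → ℕ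
numQuads {ℓ = ℓ} S = length (filter isQuad? (fourSubsets ℓ))
  where
  c = lookup (cards S)
  isQuad? : (t : Quadruple ℓ) → Dec (let (i , j , k , m) = t in SumZero (c i) (c j) (c k) (c m))
  isQuad? (i , j , k , m) = sumZero? (c i) (c j) (c k) (c m)

Realizable : ℕ → ℕ → ℕ → Set
Realizable ℓ q n = Σ (CardSet n ℓ) λ S → numQuads S ≡ q

-- D(ℓ,q) = d, where  just s  denotes the deck size s and  nothing  denotes ∞
IsD : ℕ → ℕ → Maybe ℕ → Set
IsD ℓ q (just s) = Σ ℕ λ n → (2 ^ n ≡ s) × Realizable ℓ q n × (∀ m → m < n → ¬ Realizable ℓ q m)
IsD ℓ q nothing  = ∀ n → ¬ Realizable ℓ q n

table : ℕ → ℕ → Maybe ℕ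
table 1 0 = just 1
table 2 0 = just 2
table 3 0 = just 4
table 4 0 = just 8
table 4 1 = just 4
table 5 0 = just 16
table 5 1 = just 8
table 6 0 = just 16
table 6 1 = just 16
table 6 3 = just 8
table 7 0 = just 32
table 7 1 = just 32
table 7 2 = just 16
table 7 3 = just 16
table 7 7 = just 8
table _ _ = nothing

-- Lower bounds: take coordinates of the cards with respect to a basis picked greedily among
-- the cards themselves.  This turns ℓ distinct cards of ℤ₂ⁿ into ℓ distinct vectors of ℤ₂ᵏ,
-- k ≤ n, with the same quads, and the coordinate lists that the greedy procedure can produce
-- depend on finitely many choices only, so for ℓ ≤ 7 all of them are enumerated and checked
-- against the table.  Upper bounds: explicit card sets, checked by evaluation.
module Submission where

open import Defs
open import Data.Nat using (_≤_)
open import Data.Nat as ℕ using (ℕ; zero; suc; _^_; _≤?_; z≤n; s≤s)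
open import Data.Nat.Properties using (≤-trans; <⇒≱; ≮⇒≥; ^-monoʳ-≤; ^-monoʳ-<)
open import Data.Bool using (Bool; true; false; _∧_; _∨_; T)
open import Data.Bool.Properties using (T-∧; T-≡; xor-assoc; xor-comm; xor-identityˡ; xor-identityʳ; xor-same)
  renaming (_≟_ to _≟ᵇ_)
open import Data.Empty using (⊥; ⊥-elim)
open import Data.Unit using (⊤; tt)
open import Data.Fin using (Fin; toℕ; fromℕ<)
import Data.Fin as Fin
open import Data.Fin.Patterns using (0F; 1F; 2F; 3F)
open import Data.Fin.Properties using (2↔Bool; *↔×; injective⇒≤; all?; 0≢1+n; suc-injective; toℕ-fromℕ<)
open import Data.List using (List; length; filter)
open import Data.List.Properties using (filter-≐)
open import Data.Maybe using (Maybe; just; nothing)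
open import Data.Maybe.Relation.Unary.Any as Maybe using (Any)
open import Data.Product using (Σ; _×_; _,_; proj₁; proj₂)
open import Data.Product.Function.NonDependent.Propositional using (_×-↔_)
open import Data.Sum using (inj₁; inj₂)
open import Data.Vec using (Vec; []; _∷_; lookup; map; tabulate; _++_; _[_]≔_)
open import Data.Vec.Properties using (≡-dec; lookup-map; map-∘; zipWith-assoc; zipWith-comm; zipWith-identityˡ; zipWith-identityʳ)
open import Data.Vec.Membership.Propositional.Properties using (∈-map⁺)
import Data.Vec.Membership.DecPropositional as VecMembership
open import Data.Vec.Relation.Unary.All using (All)
import Data.Vec.Relation.Unary.All as All
open import Data.Vec.Relation.Unary.All.Properties using (lookup⁻)
open import Data.Vec.Relation.Unary.AllPairs using (allPairs?; []; _∷_)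
open import Data.Vec.Relation.Unary.Unique.Propositional using (Unique)
open import Data.Vec.Relation.Unary.Unique.Propositional.Properties using (lookup-injective)
open import Function using (_∘_; _⇔_; mk⇔; _↔_; mk↔ₛ′; Injection; Equivalence)
open import Function.Definitions using (Injective)
open import Function.Properties.Inverse using (↔-trans; ↔-sym; ↔⇒↣)
open import Relation.Binary.PropositionalEquality
open import Relation.Nullary using (¬_; Dec; yes; no; does; ¬?; _×-dec_; _⊎-dec_)
open import Relation.Nullary.Decidable using (⌊_⌋; toWitness; map′)

_≟_ : ∀ {n} (x y : Card n) → Dec (x ≡ y)
_≟_ = ≡-dec _≟ᵇ_

⊕-assoc : ∀ {n} (x y z : Card n) → (x ⊕ y) ⊕ z ≡ x ⊕ (y ⊕ z)
⊕-assoc = zipWith-assoc xor-assoc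

⊕-comm : ∀ {n} (x y : Card n) → x ⊕ y ≡ y ⊕ x
⊕-comm = zipWith-comm xor-comm

⊕-identityˡ : ∀ {n} (x : Card n) → 𝟎 ⊕ x ≡ x
⊕-identityˡ = zipWith-identityˡ xor-identityˡ

⊕-identityʳ : ∀ {n} (x : Card n) → x ⊕ 𝟎 ≡ x
⊕-identityʳ = zipWith-identityʳ xor-identityʳ

⊕-self : ∀ {n} (x : Card n) → x ⊕ x ≡ 𝟎
⊕-self []      = refl
⊕-self (b ∷ x) = cong₂ _∷_ (xor-same b) (⊕-self x)

x⊕[x⊕y]≡y : ∀ {n} (x y : Card n) → x ⊕ (x ⊕ y) ≡ y
x⊕[x⊕y]≡y x y = begin
  x ⊕ (x ⊕ y) ≡⟨ ⊕-assoc x x y ⟨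
  (x ⊕ x) ⊕ y ≡⟨ cong (_⊕ y) (⊕-self x) ⟩
  𝟎 ⊕ y       ≡⟨ ⊕-identityˡ y ⟩
  y           ∎
  where open ≡-Reasoning

x⊕y≡𝟎⇒x≡y : ∀ {n} {x y : Card n} → x ⊕ y ≡ 𝟎 → x ≡ y
x⊕y≡𝟎⇒x≡y {x = x} {y} x⊕y≡𝟎 = begin
  x           ≡⟨ ⊕-identityʳ x ⟨
  x ⊕ 𝟎       ≡⟨ cong (x ⊕_) x⊕y≡𝟎 ⟨
  x ⊕ (x ⊕ y) ≡⟨ x⊕[x⊕y]≡y x y ⟩
  y           ∎
  where open ≡-Reasoning

x⊕[y⊕z]≡y⊕[x⊕z] : ∀ {n} (x y z : Card n) → x ⊕ (y ⊕ z) ≡ y ⊕ (x ⊕ z)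
x⊕[y⊕z]≡y⊕[x⊕z] x y z = begin
  x ⊕ (y ⊕ z) ≡⟨ ⊕-assoc x y z ⟨
  (x ⊕ y) ⊕ z ≡⟨ cong (_⊕ z) (⊕-comm x y) ⟩
  (y ⊕ x) ⊕ z ≡⟨ ⊕-assoc y x z ⟩
  y ⊕ (x ⊕ z) ∎
  where open ≡-Reasoning

⊕-interchange : ∀ {n} (w x y z : Card n) → (w ⊕ x) ⊕ (y ⊕ z) ≡ (w ⊕ y) ⊕ (x ⊕ z)
⊕-interchange w x y z = begin
  (w ⊕ x) ⊕ (y ⊕ z) ≡⟨ ⊕-assoc w x (y ⊕ z) ⟩
  w ⊕ (x ⊕ (y ⊕ z)) ≡⟨ cong (w ⊕_) (x⊕[y⊕z]≡y⊕[x⊕z] x y z) ⟩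
  w ⊕ (y ⊕ (x ⊕ z)) ≡⟨ ⊕-assoc w y (x ⊕ z) ⟨
  (w ⊕ y) ⊕ (x ⊕ z) ∎
  where open ≡-Reasoning

lincomb : ∀ {n k} → Card k → Vec (Card n) k → Card n
lincomb []          []      = 𝟎
lincomb (false ∷ x) (_ ∷ B) = lincomb x B
lincomb (true  ∷ x) (b ∷ B) = b ⊕ lincomb x B

lincomb-𝟎 : ∀ {n k} (B : Vec (Card n) k) → lincomb 𝟎 B ≡ 𝟎
lincomb-𝟎 []      = refl
lincomb-𝟎 (_ ∷ B) = lincomb-𝟎 B

lincomb-⊕ : ∀ {n k} (x y : Card k) (B : Vec (Card n) k) →
            lincomb (x ⊕ y) B ≡ lincomb x B ⊕ lincomb y B
lincomb-⊕ []          []          []      = sym (⊕-self 𝟎)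
lincomb-⊕ (false ∷ x) (false ∷ y) (b ∷ B) = lincomb-⊕ x y B
lincomb-⊕ (false ∷ x) (true  ∷ y) (b ∷ B) =
  trans (cong (b ⊕_) (lincomb-⊕ x y B)) (x⊕[y⊕z]≡y⊕[x⊕z] b _ _)
lincomb-⊕ (true  ∷ x) (false ∷ y) (b ∷ B) =
  trans (cong (b ⊕_) (lincomb-⊕ x y B)) (sym (⊕-assoc b _ _))
lincomb-⊕ (true  ∷ x) (true  ∷ y) (b ∷ B) = begin
  lincomb (x ⊕ y) B                         ≡⟨ lincomb-⊕ x y B ⟩
  lincomb x B ⊕ lincomb y B                 ≡⟨ ⊕-identityˡ _ ⟨
  𝟎 ⊕ (lincomb x B ⊕ lincomb y B)           ≡⟨ cong (_⊕ _) (⊕-self b) ⟨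
  (b ⊕ b) ⊕ (lincomb x B ⊕ lincomb y B)     ≡⟨ ⊕-interchange b b _ _ ⟩
  (b ⊕ lincomb x B) ⊕ (b ⊕ lincomb y B)     ∎
  where open ≡-Reasoning

LinearlyIndependent : ∀ {n k} → Vec (Card n) k → Set
LinearlyIndependent B = ∀ x → lincomb x B ≡ 𝟎 → x ≡ 𝟎

lincomb-injective : ∀ {n k} {B : Vec (Card n) k} → LinearlyIndependent B →
                    Injective _≡_ _≡_ (λ x → lincomb x B)
lincomb-injective {B = B} indep {x} {y} eq = x⊕y≡𝟎⇒x≡y (indep (x ⊕ y) (begin
  lincomb (x ⊕ y) B         ≡⟨ lincomb-⊕ x y B ⟩
  lincomb x B ⊕ lincomb y B ≡⟨ cong (_⊕ lincomb y B) eq ⟩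
  lincomb y B ⊕ lincomb y B ≡⟨ ⊕-self (lincomb y B) ⟩
  𝟎                         ∎))
  where open ≡-Reasoning

InSpan : ∀ {n k} → Vec (Card n) k → Card n → Set
InSpan {k = k} B v = Σ (Card k) λ x → lincomb x B ≡ v

inSpan? : ∀ {n k} (B : Vec (Card n) k) (v : Card n) → Dec (InSpan B v)
inSpan? []      v = map′ ([] ,_) (λ { ([] , 𝟎≡v) → 𝟎≡v }) (𝟎 ≟ v)
inSpan? (b ∷ B) v = map′ fromEither toEither (inSpan? B v ⊎-dec inSpan? B (b ⊕ v))
  where
  fromEither : _ → InSpan (b ∷ B) v
  fromEither (inj₁ (x , x↦v))  = false ∷ x , x↦v
  fromEither (inj₂ (x , x↦bv)) = true ∷ x , trans (cong (b ⊕_) x↦bv) (x⊕[x⊕y]≡y b v)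
  toEither : InSpan (b ∷ B) v → _
  toEither (false ∷ x , x↦v) = inj₁ (x , x↦v)
  toEither (true  ∷ x , x↦v) = inj₂ (x , trans (sym (x⊕[x⊕y]≡y b _)) (cong (b ⊕_) x↦v))

independent-∷ : ∀ {n k} {B : Vec (Card n) k} {v : Card n} →
                LinearlyIndependent B → ¬ InSpan B v → LinearlyIndependent (v ∷ B)
independent-∷ indep v∉B (false ∷ x) x↦𝟎 = cong (false ∷_) (indep x x↦𝟎)
independent-∷ indep v∉B (true  ∷ x) x↦𝟎 = ⊥-elim (v∉B (x , sym (x⊕y≡𝟎⇒x≡y x↦𝟎)))

∷↔× : ∀ {A : Set} {n} → Vec A (suc n) ↔ (A × Vec A n)
∷↔× = mk↔ₛ′ (λ { (x ∷ xs) → x , xs }) (λ (x , xs) → x ∷ xs) (λ _ → refl) (λ { (_ ∷ _) → refl })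

card↔fin : ∀ n → Card n ↔ Fin (2 ^ n)
card↔fin zero    = mk↔ₛ′ (λ _ → 0F) (λ _ → []) (λ { 0F → refl ; (Fin.suc ()) }) (λ { [] → refl })
card↔fin (suc n) = ↔-trans ∷↔× (↔-trans (↔-sym 2↔Bool ×-↔ card↔fin n) (↔-sym *↔×))

injective⇒dim≤ : ∀ {k n} (f : Card k → Card n) → Injective _≡_ _≡_ f → k ≤ n
injective⇒dim≤ {k} {n} f f-injective =
  ≮⇒≥ (λ n<k → <⇒≱ (^-monoʳ-< 2 (s≤s (s≤s z≤n)) n<k) (injective⇒≤ F-injective))
  where
  encode = ↔⇒↣ (card↔fin n)
  decode = ↔⇒↣ (↔-sym (card↔fin k))
  F-injective : Injective _≡_ _≡_ (Injection.to encode ∘ f ∘ Injection.to decode)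
  F-injective = Injection.injective decode ∘ f-injective ∘ Injection.injective encode

independent⇒length≤dim : ∀ {n k} {B : Vec (Card n) k} → LinearlyIndependent B → k ≤ n
independent⇒length≤dim indep = injective⇒dim≤ _ (lincomb-injective indep)

record Coordinates {n j} (ds : Vec (Card n) j) : Set where
  field
    dim         : ℕ
    basis       : Vec (Card n) dim
    independent : LinearlyIndependent basis
    coords      : Vec (Card dim) j
    decompose   : ds ≡ map (λ y → lincomb y basis) coords
open Coordinates

extendWith : ∀ {n j} {ds : Vec (Card n) j} (C : Coordinates ds) (d : Card n) →
             Dec (InSpan (basis C) d) → Coordinates (d ∷ ds)
extendWith C d (yes (x , x↦d)) = record
  { dim = dim C ; basis = basis C ; independent = independent C
  ; coords = x ∷ coords C ; decompose = cong₂ _∷_ (sym x↦d) (decompose C) }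
extendWith C d (no d∉B) = record
  { dim = suc (dim C) ; basis = d ∷ basis C ; independent = independent-∷ (independent C) d∉B
  ; coords = (true ∷ 𝟎) ∷ map (false ∷_) (coords C)
  ; decompose = cong₂ _∷_ (sym (trans (cong (d ⊕_) (lincomb-𝟎 (basis C))) (⊕-identityʳ d)))
                          (trans (decompose C) (map-∘ (λ y → lincomb y (d ∷ basis C)) (false ∷_) (coords C))) }

coordinates : ∀ {n j} (ds : Vec (Card n) j) → Coordinates ds
coordinates []       = record { dim = 0 ; basis = [] ; independent = λ { [] _ → refl }
                              ; coords = [] ; decompose = refl }
coordinates (d ∷ ds) = extendWith C d (inSpan? (basis C) d)
  where C = coordinates ds

quadSum : ∀ {n ℓ} → Vec (Card n) ℓ → Quadruple ℓ → Card n
quadSum cs (i , j , k , m) = ((lookup cs i ⊕ lookup cs j) ⊕ lookup cs k) ⊕ lookup cs m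

quadCountIn : ∀ {n ℓ} → List (Quadruple ℓ) → Vec (Card n) ℓ → ℕ
quadCountIn qs cs = length (filter (λ t → quadSum cs t ≟ 𝟎) qs)

numQuads-quadCountIn : ∀ {n ℓ} (S : CardSet n ℓ) → numQuads S ≡ quadCountIn (fourSubsets ℓ) (cards S)
numQuads-quadCountIn S = refl

quadCountIn-cong : ∀ {n k ℓ} (qs : List (Quadruple ℓ)) (cs : Vec (Card n) ℓ) (ys : Vec (Card k) ℓ) →
                   (∀ t → quadSum cs t ≡ 𝟎 ⇔ quadSum ys t ≡ 𝟎) → quadCountIn qs cs ≡ quadCountIn qs ys
quadCountIn-cong qs cs ys iff =
  cong length (filter-≐ _ _ ((λ {t} → Equivalence.to (iff t)) , (λ {t} → Equivalence.from (iff t))) qs)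

quadSum-map : ∀ {n k ℓ} (f : Card k → Card n) → (∀ x y → f (x ⊕ y) ≡ f x ⊕ f y) →
              ∀ (ys : Vec (Card k) ℓ) t → quadSum (map f ys) t ≡ f (quadSum ys t)
quadSum-map f f-additive ys (i , j , k , m)
  rewrite lookup-map i f ys | lookup-map j f ys | lookup-map k f ys | lookup-map m f ys = begin
  ((f a ⊕ f b) ⊕ f c) ⊕ f d ≡⟨ cong (λ z → (z ⊕ f c) ⊕ f d) (f-additive a b) ⟨
  (f (a ⊕ b) ⊕ f c) ⊕ f d   ≡⟨ cong (_⊕ f d) (f-additive (a ⊕ b) c) ⟨
  f ((a ⊕ b) ⊕ c) ⊕ f d     ≡⟨ f-additive ((a ⊕ b) ⊕ c) d ⟨
  f (((a ⊕ b) ⊕ c) ⊕ d)     ∎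
  where
  open ≡-Reasoning
  a = lookup ys i
  b = lookup ys j
  c = lookup ys k
  d = lookup ys m

quadCount-coords : ∀ {n ℓ} {cs : Vec (Card n) ℓ} (C : Coordinates cs) (qs : List (Quadruple ℓ)) →
                   quadCountIn qs (coords C) ≡ quadCountIn qs cs
quadCount-coords {cs = cs} C qs = begin
  quadCountIn qs (coords C)           ≡⟨ quadCountIn-cong qs (map lin (coords C)) (coords C) sums ⟨
  quadCountIn qs (map lin (coords C)) ≡⟨ cong (quadCountIn qs) (decompose C) ⟨
  quadCountIn qs cs                   ∎
  where
  open ≡-Reasoning
  lin = λ x → lincomb x (basis C)
  sums : ∀ t → quadSum (map lin (coords C)) t ≡ 𝟎 ⇔ quadSum (coords C) t ≡ 𝟎
  sums t rewrite quadSum-map lin (λ x y → lincomb-⊕ x y (basis C)) (coords C) t =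
    mk⇔ (independent C _) (λ sum≡𝟎 → trans (cong lin sum≡𝟎) (lincomb-𝟎 (basis C)))

-- Enumeration of greedy coordinates

Shape : ℕ → Set
Shape j = Σ ℕ λ k → Vec (Card k) j

shape : ∀ {n j} {ds : Vec (Card n) j} → Coordinates ds → Shape j
shape C = dim C , coords C

open module Membership {k} = VecMembership {A = Card k} _≟_ using (_∈_; _∈?_)

allCards : ∀ k → (Card k → Bool) → Bool
allCards zero    f = f []
allCards (suc k) f = allCards k (f ∘ (false ∷_)) ∧ allCards k (f ∘ (true ∷_))

allCards-sound : ∀ k (f : Card k → Bool) → T (allCards k f) → ∀ x → T (f x)
allCards-sound zero    f all-f []          = all-f
allCards-sound (suc k) f all-f (false ∷ x) = allCards-sound k _ (proj₁ (Equivalence.to T-∧ all-f)) x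
allCards-sound (suc k) f all-f (true  ∷ x) = allCards-sound k _ (proj₂ (Equivalence.to T-∧ all-f)) x

-- A new card either becomes the next basis vector, or its coordinates x in the current basis
-- differ from all older coordinate vectors.
everyExtension : ∀ {j} → (Shape (suc j) → Bool) → Shape j → Bool
everyExtension P (k , ys) =
  P (suc k , (true ∷ 𝟎) ∷ map (false ∷_) ys) ∧ allCards k (λ x → does (x ∈? ys) ∨ P (k , x ∷ ys))

everyReachable : ∀ j → (Shape j → Bool) → Bool
everyReachable zero    P = P (0 , [])
everyReachable (suc j) P = everyReachable j (everyExtension P)

everyExtension-sound : ∀ {n j} {ds : Vec (Card n) j} (P : Shape (suc j) → Bool) (C : Coordinates ds)
                       (d : Card n) (d∈? : Dec (InSpan (basis C) d)) → All (d ≢_) ds →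
                       T (everyExtension P (shape C)) → T (P (shape (extendWith C d d∈?)))
everyExtension-sound P C d (no _) _ ok = proj₁ (Equivalence.to T-∧ ok)
everyExtension-sound P C d (yes (x , x↦d)) d∉ds ok =
  new-or-P (x ∈? coords C) (allCards-sound _ _ (proj₂ (Equivalence.to T-∧ ok)) x)
  where
  x∉ys : ¬ x ∈ coords C
  x∉ys x∈ys = All.lookup d∉ds
    (subst₂ (λ z zs → z ∈ zs) x↦d (sym (decompose C)) (∈-map⁺ (λ y → lincomb y (basis C)) x∈ys)) refl
  new-or-P : (x∈? : Dec (x ∈ coords C)) → T (does x∈? ∨ P (dim C , x ∷ coords C)) →
             T (P (dim C , x ∷ coords C))
  new-or-P (yes x∈ys) _    = ⊥-elim (x∉ys x∈ys)
  new-or-P (no _)     P-ok = P-ok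

everyReachable-sound : ∀ {n j} (P : Shape j → Bool) (ds : Vec (Card n) j) → Unique ds →
                       T (everyReachable j P) → T (P (shape (coordinates ds)))
everyReachable-sound P []       _            ok = ok
everyReachable-sound P (d ∷ ds) (d∉ds ∷ uds) ok =
  everyExtension-sound P C d (inSpan? (basis C) d) d∉ds
    (everyReachable-sound (everyExtension P) ds uds ok)
  where C = coordinates ds

-- Lower bounds

Fits : ℕ → ℕ → ℕ → Set
Fits ℓ q n = Any (_≤ 2 ^ n) (table ℓ q)

fits-mono : ∀ {ℓ q k n} → k ≤ n → Fits ℓ q k → Fits ℓ q n
fits-mono k≤n = Maybe.map (λ s≤2ᵏ → ≤-trans s≤2ᵏ (^-monoʳ-≤ 2 k≤n))

-- The quadruple list is an argument, rather than  fourSubsets ℓ , so that it is evaluated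
-- once for all shapes instead of once per shape.
shapeFits : ∀ ℓ → List (Quadruple ℓ) → Shape ℓ → Bool
shapeFits ℓ qs (k , ys) = ⌊ Maybe.dec (_≤? 2 ^ k) (table ℓ (quadCountIn qs ys)) ⌋

shapeFits-sound : ∀ {ℓ} qs k (ys : Vec (Card k) ℓ) →
                  T (shapeFits ℓ qs (k , ys)) → Fits ℓ (quadCountIn qs ys) k
shapeFits-sound {ℓ} qs k ys = toWitness {a? = Maybe.dec (_≤? 2 ^ k) (table ℓ (quadCountIn qs ys))}

-- Stated with  ≡ true  rather than  T : checking  refl  is much faster than reducing  T _  to ⊤.
everyShapeFits : ∀ ℓ → 1 ≤ ℓ → ℓ ≤ 7 → everyReachable ℓ (shapeFits ℓ (fourSubsets ℓ)) ≡ true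
everyShapeFits 1 _ _ = refl
everyShapeFits 2 _ _ = refl
everyShapeFits 3 _ _ = refl
everyShapeFits 4 _ _ = refl
everyShapeFits 5 _ _ = refl
everyShapeFits 6 _ _ = refl
everyShapeFits 7 _ _ = refl
everyShapeFits (suc (suc (suc (suc (suc (suc (suc (suc _)))))))) _ (s≤s (s≤s (s≤s (s≤s (s≤s (s≤s (s≤s ())))))))

lookup-injective⇒unique : ∀ {A : Set} {j} (xs : Vec A j) → Injective _≡_ _≡_ (lookup xs) → Unique xs
lookup-injective⇒unique []       _   = []
lookup-injective⇒unique (x ∷ xs) inj =
  lookup⁻ (λ i x≡xᵢ → 0≢1+n (inj x≡xᵢ)) ∷ lookup-injective⇒unique xs (suc-injective ∘ inj)

realizable⇒fits : ∀ {ℓ q n} → 1 ≤ ℓ → ℓ ≤ 7 → Realizable ℓ q n → Fits ℓ q n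
realizable⇒fits {ℓ} 1≤ℓ ℓ≤7 (S , refl) = fits-mono (independent⇒length≤dim (independent C)) C-fits
  where
  C  = coordinates (cards S)
  qs = fourSubsets ℓ
  shape-fits : T (shapeFits ℓ qs (shape C))
  shape-fits = everyReachable-sound (shapeFits ℓ qs) (cards S)
    (lookup-injective⇒unique (cards S) (distinct S)) (Equivalence.from T-≡ (everyShapeFits ℓ 1≤ℓ ℓ≤7))
  C-fits : Fits ℓ (numQuads S) (dim C)
  C-fits = subst (λ q → Fits ℓ q (dim C))
    (trans (quadCount-coords C qs) (sym (numQuads-quadCountIn S)))
    (shapeFits-sound qs (dim C) (coords C) shape-fits)

-- Upper bounds

e : ∀ {n} → Fin n → Card n
e i = 𝟎 [ i ]≔ true

affineBasis : ∀ {n} → Vec (Card n) (suc n)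
affineBasis = 𝟎 ∷ tabulate e

Example : ℕ → Set
Example ℓ = Σ ℕ λ n → Vec (Card n) ℓ

example : ∀ ℓ → ℕ → Maybe (Example ℓ)
example 1 0 = just (0 , affineBasis)
example 2 0 = just (1 , affineBasis)
example 3 0 = just (2 , affineBasis)
example 4 0 = just (3 , affineBasis)
example 4 1 = just (2 , affineBasis ++ e 0F ⊕ e 1F ∷ [])
example 5 0 = just (4 , affineBasis)
example 5 1 = just (3 , affineBasis ++ e 0F ⊕ e 1F ∷ [])
example 6 0 = just (4 , affineBasis ++ ((e 0F ⊕ e 1F) ⊕ e 2F) ⊕ e 3F ∷ [])
example 6 1 = just (4 , affineBasis ++ e 0F ⊕ e 1F ∷ [])
example 6 3 = just (3 , affineBasis ++ e 0F ⊕ e 1F ∷ e 0F ⊕ e 2F ∷ [])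
example 7 0 = just (5 , affineBasis ++ ((e 0F ⊕ e 1F) ⊕ e 2F) ⊕ e 3F ∷ [])
example 7 1 = just (5 , affineBasis ++ e 0F ⊕ e 1F ∷ [])
example 7 2 = just (4 , affineBasis ++ e 0F ⊕ e 1F ∷ e 2F ⊕ e 3F ∷ [])
example 7 3 = just (4 , affineBasis ++ e 0F ⊕ e 1F ∷ e 0F ⊕ e 2F ∷ [])
example 7 7 = just (3 , affineBasis ++ e 0F ⊕ e 1F ∷ e 0F ⊕ e 2F ∷ e 1F ⊕ e 2F ∷ [])
example _ _ = nothing

Certifies : ∀ ℓ → ℕ → Maybe ℕ → Maybe (Example ℓ) → Set
Certifies ℓ q nothing  _               = ⊤
Certifies ℓ q (just s) nothing         = ⊥
Certifies ℓ q (just s) (just (n , cs)) = 2 ^ n ≡ s × Unique cs × quadCountIn (fourSubsets ℓ) cs ≡ q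

certifies? : ∀ ℓ q d (x : Maybe (Example ℓ)) → Dec (Certifies ℓ q d x)
certifies? ℓ q nothing  _               = yes tt
certifies? ℓ q (just s) nothing         = no λ ()
certifies? ℓ q (just s) (just (n , cs)) =
  (2 ^ n ℕ.≟ s) ×-dec allPairs? (λ x y → ¬? (x ≟ y)) cs ×-dec (quadCountIn (fourSubsets ℓ) cs ℕ.≟ q)

examplesCertify : ∀ ℓ q → ℓ ≤ 7 → q ≤ 7 → Certifies ℓ q (table ℓ q) (example ℓ q)
examplesCertify ℓ q ℓ≤7 q≤7 =
  subst₂ (λ ℓ q → Certifies ℓ q (table ℓ q) (example ℓ q)) (toℕ-fromℕ< ℓ<8) (toℕ-fromℕ< q<8)
    (allCertified (fromℕ< ℓ<8) (fromℕ< q<8))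
  where
  ℓ<8 = s≤s ℓ≤7
  q<8 = s≤s q≤7
  allCertified : ∀ (ℓ q : Fin 8) →
                 Certifies (toℕ ℓ) (toℕ q) (table (toℕ ℓ) (toℕ q)) (example (toℕ ℓ) (toℕ q))
  allCertified = toWitness {a? = all? λ ℓ → all? λ q → certifies? _ _ _ (example (toℕ ℓ) (toℕ q))} _

isD-from-bounds : ∀ {ℓ q} d {x} → (∀ {n} → Realizable ℓ q n → Any (_≤ 2 ^ n) d) →
                  Certifies ℓ q d x → IsD ℓ q d
isD-from-bounds nothing lower _ n R with lower R
... | ()
isD-from-bounds (just s) {just (n , cs)} lower (2ⁿ≡s , unique , count) =
  n , 2ⁿ≡s , (S , count) , λ m m<n R →
    <⇒≱ (^-monoʳ-< 2 (s≤s (s≤s z≤n)) m<n) (subst (_≤ 2 ^ m) (sym 2ⁿ≡s) (Maybe.drop-just (lower R)))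
  where
  S : CardSet n _
  S = record { cards = cs ; distinct = λ {i} {j} → lookup-injective unique i j }

proposition5 : ∀ ℓ q → 1 ≤ ℓ → ℓ ≤ 7 → q ≤ 7 → IsD ℓ q (table ℓ q)
proposition5 ℓ q 1≤ℓ ℓ≤7 q≤7 =
  isD-from-bounds (table ℓ q) (realizable⇒fits 1≤ℓ ℓ≤7) (examplesCertify ℓ q ℓ≤7 q≤7)
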